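{- Let $a \geq 2$ and $n \geq 1$ be integers, and define rational numbers $G_{m,a}$ ($m \in \mathbb{N}$) by $$\frac{a t}{e^{(a-1)t} + e^{(a-2)t} + \dots + e^{t} + 1} = \sum_{m=0}^{\infty} G_{m,a} \frac{t^m}{m!}$$ in $\mathbb{Q}[[t]]$. Then for every prime $p$ dividing $a$, $\vartheta_p(G_{n,a}) \geq 0$.
   Context: $\vartheta_p$ denotes the $p$-adic valuation on $\mathbb{Q}$. -}

module Defs where

open import Data.Nat as ℕ using (ℕ; zero; suc; _^_; _≤_; _!)
open import Data.Nat.Properties using (_!≢0)
open import Data.Nat.Divisibility using (_∣_)
open import Data.Integer as ℤ using (ℤ; +_)
open import Data.Rational as ℚ using (ℚ; 0ℚ; _+_; _*_; _/_; ↥_; ↧ₙ_)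
open import Data.Product using (_×_)
open import Relation.Nullary using (¬_)
open import Relation.Binary.PropositionalEquality using (_≡_)

-- Formal power series over ℚ, as coefficient sequences: f ↦ Σ f m t^m
PowerSeries : Set
PowerSeries = ℕ → ℚ

Σ< : ℕ → (ℕ → ℚ) → ℚ
Σ< zero    f = 0ℚ
Σ< (suc n) f = Σ< n f + f n

_⊛_ : PowerSeries → PowerSeries → PowerSeries
(f ⊛ g) m = Σ< (suc m) (λ k → f k * g (m ℕ.∸ k))

expSeries : ℕ → PowerSeries
expSeries j m = (+ (j ^ m) / (m !)) {{m !≢0}}

denomSeries : ℕ → PowerSeries
denomSeries a m = Σ< a (λ j → expSeries j m)

atSeries : ℕ → PowerSeries
atSeries a zero          = 0ℚ
atSeries a (suc zero)    = + a / 1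
atSeries a (suc (suc m)) = 0ℚ

egf : (ℕ → ℚ) → PowerSeries
egf G m = G m * (+ 1 / (m !)) {{m !≢0}}

-- G is the sequence defined by  a t / (e^{(a-1)t}+...+1) = Σ G m t^m/m!
-- (stated multiplied out: denominator · EGF(G) = a t, coefficientwise)
IsGSeq : ℕ → (ℕ → ℚ) → Set
IsGSeq a G = ∀ m → (denomSeries a ⊛ egf G) m ≡ atSeries a m

ValIs : ℕ → ℕ → ℕ → Set
ValIs p n k = (p ^ k ∣ n) × ¬ (p ^ suc k ∣ n)

-- ϑ_p(x) ≥ 0 for x ∈ ℚ: either x = 0 (valuation +∞), or, writing
-- x = u/v in lowest terms, ϑ_p(x) = ν_p(|u|) - ν_p(v) ≥ 0.
ValNonneg : ℕ → ℚ → Set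
ValNonneg p x =
  ¬ (x ≡ 0ℚ) →
  ∀ k₁ k₂ → ValIs p (ℤ.∣ ↥ x ∣) k₁ → ValIs p (↧ₙ x) k₂ → k₂ ≤ k₁

{-# OPTIONS --safe #-}

-- Multiplying  a t / Σ_{j<a} e^{jt} = Σ_m G_m t^m/m!  by (e^t − 1)/t telescopes the
-- denominator into (e^{at} − 1)/t = Σ_k a^{k+1} t^k/(k+1)!.  Comparing coefficients of
-- t^n/n! gives  Σ_{k≤n} C(n,k) a^{k+1}/(k+1) · G_{n−k} = a·[n ≥ 1],  so G_0 = 0 and
--   G_n = 1 − Σ_{1≤k≤n} C(n,k) a^k/(k+1) · G_{n−k}   (n ≥ 1).
-- When p ∣ a each a^k/(k+1) is p-integral (pˢ ∣ k+1 forces s ≤ k), so by strong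
-- induction every G_n is p-integral, i.e. ϑ_p(G_n) ≥ 0 (also for n = 0, as G_0 = 0).

module Submission where

open import Defs
open import Data.Nat using (ℕ; _≥_)
open import Data.Nat.Divisibility using (_∣_)
open import Data.Nat.Primality using (Prime)
open import Data.Rational using (ℚ)

open import Data.Nat as ℕ using (zero; suc; NonZero; _∸_; _<_; _≤_; s≤s; z≤n; _!; _^_)
import Data.Nat.Properties as ℕ
open import Data.Nat.Properties using (_!≢0; _!*_!≢0; m*n≢0)
open import Data.Nat.Divisibility
open import Data.Nat.Primality using (euclidsLemma; ¬prime[1]; prime⇒nonZero; prime⇒nonTrivial)
import Data.Nat.Coprimality as Coprime
open import Data.Nat.Combinatorics using (_C_; nCk≡n!/k![n-k]!; k![n∸k]!∣n!)
open import Data.Nat.DivMod using (m*[n/m]≡n)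
open import Data.Nat.Induction using (<-rec; <-wellFounded)
open import Induction.WellFounded using (Acc; acc)
import Data.Nat.Solver as ℕ-Solver
open import Data.Integer as ℤ using (ℤ; +_)
import Data.Integer.Properties as ℤ
open import Data.Rational as ℚ using (mkℚ; 0ℚ; 1ℚ; _+_; _*_; _-_; _/_; -_)
open import Data.Rational.Properties
import Data.Rational.Unnormalised as ℚᵘ
import Data.Rational.Unnormalised.Properties as ℚᵘ
import Data.Rational.Solver as ℚ-Solver
open import Data.Product using (Σ-syntax; _×_; _,_)
open import Data.Sum using (inj₁; inj₂)
open import Data.Empty using (⊥-elim)
open import Relation.Nullary using (¬_; yes; no)
open import Relation.Binary.PropositionalEquality
open ≡-Reasoning

toℚᵘ-/ : ∀ i d .{{_ : NonZero d}} → ℚ.toℚᵘ (i / d) ℚᵘ.≃ ℚᵘ.mkℚᵘ i (ℕ.pred d)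
toℚᵘ-/ i (suc d) = toℚᵘ-fromℚᵘ (ℚᵘ.mkℚᵘ i d)

/-cong-cross : ∀ i j d e .{{_ : NonZero d}} .{{_ : NonZero e}} →
               i ℤ.* + e ≡ j ℤ.* + d → i / d ≡ j / e
/-cong-cross i j d@(suc _) e@(suc _) eq = toℚᵘ-injective
  (ℚᵘ.≃-trans (toℚᵘ-/ i d) (ℚᵘ.≃-trans (ℚᵘ.*≡* eq) (ℚᵘ.≃-sym (toℚᵘ-/ j e))))

/-*-/ : ∀ i j d e .{{_ : NonZero d}} .{{_ : NonZero e}} →
        (i / d) * (j / e) ≡ ((i ℤ.* j) / (d ℕ.* e)) {{m*n≢0 d e}}
/-*-/ i j d@(suc _) e@(suc _) = toℚᵘ-injective
  (ℚᵘ.≃-trans (toℚᵘ-homo-* (i / d) (j / e))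
  (ℚᵘ.≃-trans (ℚᵘ.*-cong (toℚᵘ-/ i d) (toℚᵘ-/ j e))
               (ℚᵘ.≃-sym (toℚᵘ-/ (i ℤ.* j) (d ℕ.* e)))))

/-+-/ : ∀ i j d e .{{_ : NonZero d}} .{{_ : NonZero e}} →
        (i / d) + (j / e) ≡ ((i ℤ.* + e ℤ.+ j ℤ.* + d) / (d ℕ.* e)) {{m*n≢0 d e}}
/-+-/ i j d@(suc _) e@(suc _) = toℚᵘ-injective
  (ℚᵘ.≃-trans (toℚᵘ-homo-+ (i / d) (j / e))
  (ℚᵘ.≃-trans (ℚᵘ.+-cong (toℚᵘ-/ i d) (toℚᵘ-/ j e))
               (ℚᵘ.≃-sym (toℚᵘ-/ _ (d ℕ.* e)))))

/≡/⇒cross : ∀ i j d e .{{_ : NonZero d}} .{{_ : NonZero e}} →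
             i / d ≡ j / e → i ℤ.* + e ≡ j ℤ.* + d
/≡/⇒cross i j d@(suc _) e@(suc _) eq
  with ℚᵘ.≃-trans (ℚᵘ.≃-sym (toℚᵘ-/ i d)) (ℚᵘ.≃-trans (toℚᵘ-cong eq) (toℚᵘ-/ j e))
... | ℚᵘ.*≡* cross = cross

-‿/ : ∀ i d .{{_ : NonZero d}} → - (i / d) ≡ (ℤ.- i) / d
-‿/ i d@(suc _) = toℚᵘ-injective
  (ℚᵘ.≃-trans (toℚᵘ-homo‿- (i / d))
  (ℚᵘ.≃-trans (ℚᵘ.-‿cong (toℚᵘ-/ i d)) (ℚᵘ.≃-sym (toℚᵘ-/ (ℤ.- i) d))))

+/-cong-cross : ∀ m n d e .{{_ : NonZero d}} .{{_ : NonZero e}} →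
                m ℕ.* e ≡ n ℕ.* d → + m / d ≡ + n / e
+/-cong-cross m n d e eq = /-cong-cross (+ m) (+ n) d e
  (trans (sym (ℤ.pos-* m e)) (trans (cong +_ eq) (ℤ.pos-* n d)))

+/-*-+/ : ∀ m n d e .{{_ : NonZero d}} .{{_ : NonZero e}} →
          (+ m / d) * (+ n / e) ≡ (+ (m ℕ.* n) / (d ℕ.* e)) {{m*n≢0 d e}}
+/-*-+/ m n d e = trans (/-*-/ (+ m) (+ n) d e)
  (cong (λ z → (z / (d ℕ.* e)) {{m*n≢0 d e}}) (sym (ℤ.pos-* m n)))

-- Opaque: otherwise unification unfolds the gcd normalisation inside _/_ and gets stuck.
opaque
  fromℕ : ℕ → ℚ
  fromℕ n = + n / 1

  fromℕ-def : ∀ n → fromℕ n ≡ + n / 1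
  fromℕ-def n = refl

fromℕ-0 : fromℕ 0 ≡ 0ℚ
fromℕ-0 = fromℕ-def 0

fromℕ-1 : fromℕ 1 ≡ 1ℚ
fromℕ-1 = fromℕ-def 1

fromℕ-+ : ∀ m n → fromℕ (m ℕ.+ n) ≡ fromℕ m + fromℕ n
fromℕ-+ m n rewrite fromℕ-def (m ℕ.+ n) | fromℕ-def m | fromℕ-def n =
  sym (trans (/-+-/ (+ m) (+ n) 1 1)
             (cong (_/ 1) (cong₂ ℤ._+_ (ℤ.*-identityʳ (+ m)) (ℤ.*-identityʳ (+ n)))))

fromℕ-* : ∀ m n → fromℕ (m ℕ.* n) ≡ fromℕ m * fromℕ n
fromℕ-* m n rewrite fromℕ-def (m ℕ.* n) | fromℕ-def m | fromℕ-def n = sym (+/-*-+/ m n 1 1)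

1/n*n≡1 : ∀ n .{{_ : NonZero n}} → (+ 1 / n) * fromℕ n ≡ 1ℚ
1/n*n≡1 n rewrite fromℕ-def n = trans (+/-*-+/ 1 n n 1)
  (+/-cong-cross (1 ℕ.* n) 1 (n ℕ.* 1) 1 {{m*n≢0 n 1}}
    (trans (ℕ.*-identityʳ (1 ℕ.* n)) (cong (1 ℕ.*_) (sym (ℕ.*-identityʳ n)))))

fromℕ-*-+/ : ∀ m n d .{{_ : NonZero d}} → fromℕ m * (+ n / d) ≡ + (m ℕ.* n) / d
fromℕ-*-+/ m n d rewrite fromℕ-def m = trans (+/-*-+/ m n 1 d)
  (+/-cong-cross (m ℕ.* n) (m ℕ.* n) (1 ℕ.* d) d {{m*n≢0 1 d}}
    (cong (m ℕ.* n ℕ.*_) (sym (ℕ.*-identityˡ d))))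

*-cancelʳ-fromℕ : ∀ n .{{_ : NonZero n}} x y → x * fromℕ n ≡ y * fromℕ n → x ≡ y
*-cancelʳ-fromℕ n x y eq = begin
  x                          ≡⟨ sym (*-identityʳ x) ⟩
  x * 1ℚ                     ≡⟨ cong (x *_) (sym n*1/n) ⟩
  x * (fromℕ n * (+ 1 / n))  ≡⟨ sym (*-assoc x _ _) ⟩
  (x * fromℕ n) * (+ 1 / n)  ≡⟨ cong (_* (+ 1 / n)) eq ⟩
  (y * fromℕ n) * (+ 1 / n)  ≡⟨ *-assoc y _ _ ⟩
  y * (fromℕ n * (+ 1 / n))  ≡⟨ cong (y *_) n*1/n ⟩
  y * 1ℚ                     ≡⟨ *-identityʳ y ⟩
  y                          ∎
  where
  n*1/n : fromℕ n * (+ 1 / n) ≡ 1ℚ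
  n*1/n = trans (*-comm (fromℕ n) (+ 1 / n)) (1/n*n≡1 n)

Σ<-cong : ∀ n {f g : ℕ → ℚ} → (∀ i → i < n → f i ≡ g i) → Σ< n f ≡ Σ< n g
Σ<-cong zero    eq = refl
Σ<-cong (suc n) eq = cong₂ _+_ (Σ<-cong n (λ i i<n → eq i (ℕ.m<n⇒m<1+n i<n))) (eq n (ℕ.n<1+n n))

Σ<-cong′ : ∀ n {f g : ℕ → ℚ} → (∀ i → f i ≡ g i) → Σ< n f ≡ Σ< n g
Σ<-cong′ n eq = Σ<-cong n (λ i _ → eq i)

Σ<-zero : ∀ n → Σ< n (λ _ → 0ℚ) ≡ 0ℚ
Σ<-zero zero    = refl
Σ<-zero (suc n) = trans (+-identityʳ _) (Σ<-zero n)

Σ<-+ : ∀ n f g → Σ< n (λ i → f i + g i) ≡ Σ< n f + Σ< n g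
Σ<-+ zero    f g = refl
Σ<-+ (suc n) f g = trans (cong (_+ (f n + g n)) (Σ<-+ n f g)) (interchange (Σ< n f) (Σ< n g) (f n) (g n))
  where
  open ℚ-Solver.+-*-Solver
  interchange : ∀ w x y z → (w + x) + (y + z) ≡ (w + y) + (x + z)
  interchange = solve 4 (λ w x y z → (w :+ x) :+ (y :+ z) := (w :+ y) :+ (x :+ z)) refl

*-distribˡ-Σ< : ∀ n c f → c * Σ< n f ≡ Σ< n (λ i → c * f i)
*-distribˡ-Σ< zero    c f = *-zeroʳ c
*-distribˡ-Σ< (suc n) c f =
  trans (*-distribˡ-+ c (Σ< n f) (f n)) (cong (_+ c * f n) (*-distribˡ-Σ< n c f))

*-distribʳ-Σ< : ∀ n c f → Σ< n f * c ≡ Σ< n (λ i → f i * c)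
*-distribʳ-Σ< n c f =
  trans (*-comm _ c) (trans (*-distribˡ-Σ< n c f) (Σ<-cong′ n (λ i → *-comm c (f i))))

Σ<-head : ∀ n f → Σ< (suc n) f ≡ f 0 + Σ< n (λ i → f (suc i))
Σ<-head zero    f = trans (+-identityˡ (f 0)) (sym (+-identityʳ (f 0)))
Σ<-head (suc n) f = trans (cong (_+ f (suc n)) (Σ<-head n f)) (+-assoc (f 0) _ (f (suc n)))

Σ<-comm : ∀ n m (f : ℕ → ℕ → ℚ) → Σ< n (λ i → Σ< m (f i)) ≡ Σ< m (λ j → Σ< n (λ i → f i j))
Σ<-comm zero    m f = sym (Σ<-zero m)
Σ<-comm (suc n) m f = trans (cong (_+ Σ< m (f n)) (Σ<-comm n m f)) (sym (Σ<-+ m _ (f n)))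

Σ<-telescope : ∀ n (u f : ℕ → ℚ) → (∀ j → u j + f j ≡ f (suc j)) → Σ< n u + f 0 ≡ f n
Σ<-telescope zero    u f step = +-identityˡ (f 0)
Σ<-telescope (suc n) u f step = begin
  (Σ< n u + u n) + f 0  ≡⟨ +-assoc (Σ< n u) (u n) (f 0) ⟩
  Σ< n u + (u n + f 0)  ≡⟨ cong (λ t → Σ< n u + t) (+-comm (u n) (f 0)) ⟩
  Σ< n u + (f 0 + u n)  ≡⟨ sym (+-assoc (Σ< n u) (f 0) (u n)) ⟩
  (Σ< n u + f 0) + u n  ≡⟨ cong (_+ u n) (Σ<-telescope n u f step) ⟩
  f n + u n             ≡⟨ +-comm (f n) (u n) ⟩
  u n + f n             ≡⟨ step n ⟩
  f (suc n)             ∎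

Σ<-triangle : ∀ N (X : ℕ → ℕ → ℚ) →
  Σ< N (λ k → Σ< (suc k) (λ i → X i k)) ≡ Σ< N (λ i → Σ< (N ∸ i) (λ j → X i (i ℕ.+ j)))
Σ<-triangle zero    X = refl
Σ<-triangle (suc N) X = sym (begin
  Σ< (suc N) (λ i → Σ< (suc N ∸ i) (row i))
    ≡⟨ Σ<-cong (suc N) (λ i i<1+N → row-suc i (ℕ.≤-pred i<1+N)) ⟩
  Σ< (suc N) (λ i → Σ< (N ∸ i) (row i) + X i N)
    ≡⟨ Σ<-+ (suc N) (λ i → Σ< (N ∸ i) (row i)) (λ i → X i N) ⟩
  (Σ< N (λ i → Σ< (N ∸ i) (row i)) + Σ< (N ∸ N) (row N)) + Σ< (suc N) (λ i → X i N)
    ≡⟨ cong (λ t → (Σ< N (λ i → Σ< (N ∸ i) (row i)) + Σ< t (row N)) + Σ< (suc N) (λ i → X i N))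
            (ℕ.n∸n≡0 N) ⟩
  (Σ< N (λ i → Σ< (N ∸ i) (row i)) + 0ℚ) + Σ< (suc N) (λ i → X i N)
    ≡⟨ cong (_+ Σ< (suc N) (λ i → X i N)) (trans (+-identityʳ _) (sym (Σ<-triangle N X))) ⟩
  Σ< N (λ k → Σ< (suc k) (λ i → X i k)) + Σ< (suc N) (λ i → X i N) ∎)
  where
  row : ℕ → ℕ → ℚ
  row i j = X i (i ℕ.+ j)
  row-suc : ∀ i → i ≤ N → Σ< (suc N ∸ i) (row i) ≡ Σ< (N ∸ i) (row i) + X i N
  row-suc i i≤N rewrite ℕ.+-∸-assoc 1 i≤N =
    cong (λ t → Σ< (N ∸ i) (row i) + t) (cong (X i) (ℕ.m+[n∸m]≡n i≤N))

⊛-cong : ∀ {f f′ g g′ : PowerSeries} → (∀ i → f i ≡ f′ i) → (∀ i → g i ≡ g′ i) →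
         ∀ m → (f ⊛ g) m ≡ (f′ ⊛ g′) m
⊛-cong f≗f′ g≗g′ m = Σ<-cong′ (suc m) (λ k → cong₂ _*_ (f≗f′ k) (g≗g′ (m ∸ k)))

⊛-assoc : ∀ (f g h : PowerSeries) m → ((f ⊛ g) ⊛ h) m ≡ (f ⊛ (g ⊛ h)) m
⊛-assoc f g h m = begin
  Σ< (suc m) (λ k → (f ⊛ g) k * h (m ∸ k))
    ≡⟨ Σ<-cong′ (suc m) (λ k → *-distribʳ-Σ< (suc k) (h (m ∸ k)) (λ i → f i * g (k ∸ i))) ⟩
  Σ< (suc m) (λ k → Σ< (suc k) (λ i → f i * g (k ∸ i) * h (m ∸ k)))
    ≡⟨ Σ<-triangle (suc m) (λ i k → f i * g (k ∸ i) * h (m ∸ k)) ⟩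
  Σ< (suc m) (λ i → Σ< (suc m ∸ i) (λ j → f i * g ((i ℕ.+ j) ∸ i) * h (m ∸ (i ℕ.+ j))))
    ≡⟨ Σ<-cong (suc m) row ⟩
  (f ⊛ (g ⊛ h)) m ∎
  where
  row : ∀ i → i < suc m →
        Σ< (suc m ∸ i) (λ j → f i * g ((i ℕ.+ j) ∸ i) * h (m ∸ (i ℕ.+ j)))
          ≡ f i * (g ⊛ h) (m ∸ i)
  row i i<1+m rewrite ℕ.+-∸-assoc 1 (ℕ.≤-pred i<1+m) = begin
    Σ< (suc (m ∸ i)) (λ j → f i * g ((i ℕ.+ j) ∸ i) * h (m ∸ (i ℕ.+ j)))
      ≡⟨ Σ<-cong′ (suc (m ∸ i)) (λ j → trans (*-assoc (f i) _ _)
           (cong₂ (λ u v → f i * (g u * h v)) (ℕ.m+n∸m≡n i j) (sym (ℕ.∸-+-assoc m i j)))) ⟩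
    Σ< (suc (m ∸ i)) (λ j → f i * (g j * h ((m ∸ i) ∸ j)))
      ≡⟨ sym (*-distribˡ-Σ< (suc (m ∸ i)) (f i) _) ⟩
    f i * (g ⊛ h) (m ∸ i) ∎

⊛-scaleˡ : ∀ c (f g : PowerSeries) m → ((λ k → c * f k) ⊛ g) m ≡ c * (f ⊛ g) m
⊛-scaleˡ c f g m = trans (Σ<-cong′ (suc m) (λ k → *-assoc c (f k) (g (m ∸ k))))
  (sym (*-distribˡ-Σ< (suc m) c (λ k → f k * g (m ∸ k))))

⊛-scaleʳ : ∀ c (f g : PowerSeries) m → (f ⊛ (λ k → c * g k)) m ≡ c * (f ⊛ g) m
⊛-scaleʳ c f g m =
  trans (Σ<-cong′ (suc m) commute) (sym (*-distribˡ-Σ< (suc m) c (λ k → f k * g (m ∸ k))))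
  where
  commute : ∀ k → f k * (c * g (m ∸ k)) ≡ c * (f k * g (m ∸ k))
  commute k =
    trans (sym (*-assoc (f k) c _)) (trans (cong (_* g (m ∸ k)) (*-comm (f k) c)) (*-assoc c (f k) _))

∂ : PowerSeries → PowerSeries
∂ f k = fromℕ (suc k) * f (suc k)

∂-⊛ : ∀ (f g : PowerSeries) m → fromℕ (suc m) * (f ⊛ g) (suc m) ≡ (∂ f ⊛ g) m + (f ⊛ ∂ g) m
∂-⊛ f g m = begin
  fromℕ (suc m) * (f ⊛ g) (suc m)
    ≡⟨ *-distribˡ-Σ< (suc (suc m)) (fromℕ (suc m)) term ⟩
  Σ< (suc (suc m)) (λ k → fromℕ (suc m) * term k)
    ≡⟨ Σ<-cong (suc (suc m)) split ⟩
  Σ< (suc (suc m)) (λ k → fromℕ k * term k + fromℕ (suc m ∸ k) * term k)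
    ≡⟨ Σ<-+ (suc (suc m)) (λ k → fromℕ k * term k) (λ k → fromℕ (suc m ∸ k) * term k) ⟩
  Σ< (suc (suc m)) (λ k → fromℕ k * term k) + Σ< (suc (suc m)) (λ k → fromℕ (suc m ∸ k) * term k)
    ≡⟨ cong₂ _+_ left right ⟩
  (∂ f ⊛ g) m + (f ⊛ ∂ g) m ∎
  where
  term : ℕ → ℚ
  term k = f k * g (suc m ∸ k)

  vanish : ∀ k → fromℕ 0 * term k ≡ 0ℚ
  vanish k = trans (cong (_* term k) fromℕ-0) (*-zeroˡ (term k))

  split : ∀ k → k < suc (suc m) →
          fromℕ (suc m) * term k ≡ fromℕ k * term k + fromℕ (suc m ∸ k) * term k
  split k k<2+m = begin
    fromℕ (suc m) * term k
      ≡⟨ cong (λ n → fromℕ n * term k) (sym (ℕ.m+[n∸m]≡n (ℕ.≤-pred k<2+m))) ⟩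
    fromℕ (k ℕ.+ (suc m ∸ k)) * term k
      ≡⟨ cong (_* term k) (fromℕ-+ k (suc m ∸ k)) ⟩
    (fromℕ k + fromℕ (suc m ∸ k)) * term k
      ≡⟨ *-distribʳ-+ (term k) (fromℕ k) (fromℕ (suc m ∸ k)) ⟩
    fromℕ k * term k + fromℕ (suc m ∸ k) * term k ∎

  left : Σ< (suc (suc m)) (λ k → fromℕ k * term k) ≡ (∂ f ⊛ g) m
  left = begin
    Σ< (suc (suc m)) (λ k → fromℕ k * term k)
      ≡⟨ Σ<-head (suc m) (λ k → fromℕ k * term k) ⟩
    fromℕ 0 * term 0 + Σ< (suc m) (λ k → fromℕ (suc k) * (f (suc k) * g (m ∸ k)))
      ≡⟨ cong₂ _+_ (vanish 0)
                   (Σ<-cong′ (suc m) (λ k → sym (*-assoc (fromℕ (suc k)) (f (suc k)) _))) ⟩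
    0ℚ + (∂ f ⊛ g) m
      ≡⟨ +-identityˡ _ ⟩
    (∂ f ⊛ g) m ∎

  shift : ∀ k → k < suc m → fromℕ (suc m ∸ k) * term k ≡ f k * ∂ g (m ∸ k)
  shift k k<1+m rewrite ℕ.+-∸-assoc 1 (ℕ.≤-pred k<1+m) =
    trans (sym (*-assoc (fromℕ (suc (m ∸ k))) (f k) _))
      (trans (cong (_* g (suc (m ∸ k))) (*-comm (fromℕ (suc (m ∸ k))) (f k))) (*-assoc (f k) _ _))

  right : Σ< (suc (suc m)) (λ k → fromℕ (suc m ∸ k) * term k) ≡ (f ⊛ ∂ g) m
  right = begin
    Σ< (suc m) (λ k → fromℕ (suc m ∸ k) * term k) + fromℕ (suc m ∸ suc m) * term (suc m)
      ≡⟨ cong₂ _+_ (Σ<-cong (suc m) shift)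
           (trans (cong (λ n → fromℕ n * term (suc m)) (ℕ.n∸n≡0 (suc m))) (vanish (suc m))) ⟩
    (f ⊛ ∂ g) m + 0ℚ
      ≡⟨ +-identityʳ _ ⟩
    (f ⊛ ∂ g) m ∎

∂-expSeries : ∀ i k → ∂ (expSeries i) k ≡ fromℕ i * expSeries i k
∂-expSeries i k = begin
  fromℕ (suc k) * (+ (i ^ suc k) / suc k !) {{suc k !≢0}}
    ≡⟨ fromℕ-*-+/ (suc k) (i ^ suc k) (suc k !) {{suc k !≢0}} ⟩
  (+ (suc k ℕ.* i ^ suc k) / suc k !) {{suc k !≢0}}
    ≡⟨ +/-cong-cross (suc k ℕ.* i ^ suc k) (i ℕ.* i ^ k) (suc k !) (k !) {{suc k !≢0}} {{k !≢0}}
                     (rearrange k i (i ^ k) (k !)) ⟩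
  (+ (i ℕ.* i ^ k) / k !) {{k !≢0}}
    ≡⟨ sym (fromℕ-*-+/ i (i ^ k) (k !) {{k !≢0}}) ⟩
  fromℕ i * expSeries i k ∎
  where
  open ℕ-Solver.+-*-Solver
  rearrange : ∀ k i p f → (suc k ℕ.* (i ℕ.* p)) ℕ.* f ≡ (i ℕ.* p) ℕ.* (suc k ℕ.* f)
  rearrange = solve 4 (λ k i p f → ((con 1 :+ k) :* (i :* p)) :* f := (i :* p) :* ((con 1 :+ k) :* f)) refl

expSeries-+ : ∀ i j m → (expSeries i ⊛ expSeries j) m ≡ expSeries (i ℕ.+ j) m
expSeries-+ i j zero    = trans (+-identityˡ (1ℚ * 1ℚ)) (*-identityˡ 1ℚ)
expSeries-+ i j (suc m) = *-cancelʳ-fromℕ (suc m) _ _ (begin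
  (eᵢ ⊛ eⱼ) (suc m) * fromℕ (suc m)
    ≡⟨ *-comm _ (fromℕ (suc m)) ⟩
  fromℕ (suc m) * (eᵢ ⊛ eⱼ) (suc m)
    ≡⟨ ∂-⊛ eᵢ eⱼ m ⟩
  (∂ eᵢ ⊛ eⱼ) m + (eᵢ ⊛ ∂ eⱼ) m
    ≡⟨ cong₂ _+_ (⊛-cong {g = eⱼ} {g′ = eⱼ} (∂-expSeries i) (λ _ → refl) m)
                 (⊛-cong {f = eᵢ} {f′ = eᵢ} (λ _ → refl) (∂-expSeries j) m) ⟩
  ((λ k → fromℕ i * eᵢ k) ⊛ eⱼ) m + (eᵢ ⊛ (λ k → fromℕ j * eⱼ k)) m
    ≡⟨ cong₂ _+_ (⊛-scaleˡ (fromℕ i) eᵢ eⱼ m) (⊛-scaleʳ (fromℕ j) eᵢ eⱼ m) ⟩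
  fromℕ i * (eᵢ ⊛ eⱼ) m + fromℕ j * (eᵢ ⊛ eⱼ) m
    ≡⟨ sym (*-distribʳ-+ _ (fromℕ i) (fromℕ j)) ⟩
  (fromℕ i + fromℕ j) * (eᵢ ⊛ eⱼ) m
    ≡⟨ cong₂ _*_ (sym (fromℕ-+ i j)) (expSeries-+ i j m) ⟩
  fromℕ (i ℕ.+ j) * expSeries (i ℕ.+ j) m
    ≡⟨ sym (∂-expSeries (i ℕ.+ j) m) ⟩
  fromℕ (suc m) * expSeries (i ℕ.+ j) (suc m)
    ≡⟨ *-comm (fromℕ (suc m)) _ ⟩
  expSeries (i ℕ.+ j) (suc m) * fromℕ (suc m) ∎)
  where
  eᵢ eⱼ : PowerSeries
  eᵢ = expSeries i
  eⱼ = expSeries j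

_÷t : PowerSeries → PowerSeries
(f ÷t) k = f (suc k)

expSeries-zero-suc : ∀ m → expSeries 0 (suc m) ≡ 0ℚ
expSeries-zero-suc m = +/-cong-cross 0 0 (suc m !) 1 {{suc m !≢0}} refl

expSeries-÷t-⊛ : ∀ j m →
  ((expSeries 1 ÷t) ⊛ expSeries j) m + expSeries j (suc m) ≡ expSeries (suc j) (suc m)
expSeries-÷t-⊛ j m = begin
  ((expSeries 1 ÷t) ⊛ expSeries j) m + expSeries j (suc m)
    ≡⟨ +-comm _ (expSeries j (suc m)) ⟩
  expSeries j (suc m) + ((expSeries 1 ÷t) ⊛ expSeries j) m
    ≡⟨ cong (_+ ((expSeries 1 ÷t) ⊛ expSeries j) m) (sym (*-identityˡ (expSeries j (suc m)))) ⟩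
  expSeries 1 0 * expSeries j (suc m) + ((expSeries 1 ÷t) ⊛ expSeries j) m
    ≡⟨ sym (Σ<-head (suc m) (λ k → expSeries 1 k * expSeries j (suc m ∸ k))) ⟩
  (expSeries 1 ⊛ expSeries j) (suc m)
    ≡⟨ expSeries-+ 1 j (suc m) ⟩
  expSeries (suc j) (suc m) ∎

expSeries-÷t-⊛-denomSeries : ∀ a m → ((expSeries 1 ÷t) ⊛ denomSeries a) m ≡ (expSeries a ÷t) m
expSeries-÷t-⊛-denomSeries a m = begin
  Σ< (suc m) (λ k → E k * Σ< a (λ j → expSeries j (m ∸ k)))
    ≡⟨ Σ<-cong′ (suc m) (λ k → *-distribˡ-Σ< a (E k) (λ j → expSeries j (m ∸ k))) ⟩
  Σ< (suc m) (λ k → Σ< a (λ j → E k * expSeries j (m ∸ k)))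
    ≡⟨ Σ<-comm (suc m) a (λ k j → E k * expSeries j (m ∸ k)) ⟩
  Σ< a (λ j → (E ⊛ expSeries j) m)
    ≡⟨ sym (+-identityʳ _) ⟩
  Σ< a (λ j → (E ⊛ expSeries j) m) + 0ℚ
    ≡⟨ cong (λ t → Σ< a (λ j → (E ⊛ expSeries j) m) + t) (sym (expSeries-zero-suc m)) ⟩
  Σ< a (λ j → (E ⊛ expSeries j) m) + expSeries 0 (suc m)
    ≡⟨ Σ<-telescope a (λ j → (E ⊛ expSeries j) m) (λ j → expSeries j (suc m))
                      (λ j → expSeries-÷t-⊛ j m) ⟩
  expSeries a (suc m) ∎
  where
  E : PowerSeries
  E = expSeries 1 ÷t

⊛-atSeries-zero : ∀ f a → (f ⊛ atSeries a) 0 ≡ 0ℚ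
⊛-atSeries-zero f a = trans (+-identityˡ (f 0 * 0ℚ)) (*-zeroʳ (f 0))

⊛-atSeries-suc : ∀ f a m → (f ⊛ atSeries a) (suc m) ≡ f m * fromℕ a
⊛-atSeries-suc f a m = begin
  (Σ< m term + f m * atSeries a (suc m ∸ m)) + f (suc m) * atSeries a (m ∸ m)
    ≡⟨ cong₂ _+_ (cong₂ _+_ (trans (Σ<-cong m far) (Σ<-zero m))
                             (cong (λ n → f m * atSeries a n) (ℕ.m+n∸n≡m 1 m)))
                 (trans (cong (λ n → f (suc m) * atSeries a n) (ℕ.n∸n≡0 m)) (*-zeroʳ (f (suc m)))) ⟩
  (0ℚ + f m * (+ a / 1)) + 0ℚ
    ≡⟨ trans (+-identityʳ _) (+-identityˡ _) ⟩
  f m * (+ a / 1)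
    ≡⟨ cong (f m *_) (sym (fromℕ-def a)) ⟩
  f m * fromℕ a ∎
  where
  term : ℕ → ℚ
  term k = f k * atSeries a (suc m ∸ k)
  gap : ∀ m k → k < m → suc m ∸ k ≡ suc (suc (m ∸ suc k))
  gap (suc m) k (s≤s k≤m) =
    trans (ℕ.+-∸-assoc 1 (ℕ.m≤n⇒m≤1+n k≤m)) (cong suc (ℕ.+-∸-assoc 1 k≤m))
  far : ∀ k → k < m → term k ≡ 0ℚ
  far k k<m = trans (cong (λ n → f k * atSeries a n) (gap m k k<m)) (*-zeroʳ (f k))

expSeries-÷t-⊛-egf : ∀ a G → IsGSeq a G →
  ∀ n → ((expSeries a ÷t) ⊛ egf G) n ≡ ((expSeries 1 ÷t) ⊛ atSeries a) n
expSeries-÷t-⊛-egf a G isG n = begin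
  ((expSeries a ÷t) ⊛ egf G) n
    ≡⟨ ⊛-cong {g = egf G} {g′ = egf G} (λ k → sym (expSeries-÷t-⊛-denomSeries a k)) (λ _ → refl) n ⟩
  (((expSeries 1 ÷t) ⊛ denomSeries a) ⊛ egf G) n
    ≡⟨ ⊛-assoc (expSeries 1 ÷t) (denomSeries a) (egf G) n ⟩
  ((expSeries 1 ÷t) ⊛ (denomSeries a ⊛ egf G)) n
    ≡⟨ ⊛-cong {f = expSeries 1 ÷t} {f′ = expSeries 1 ÷t} (λ _ → refl) isG n ⟩
  ((expSeries 1 ÷t) ⊛ atSeries a) n ∎

n!≡k![n∸k]!*nCk : ∀ n k → k ≤ n → n ! ≡ (k ! ℕ.* (n ∸ k) !) ℕ.* (n C k)
n!≡k![n∸k]!*nCk n k k≤n = sym (trans (cong ((k ! ℕ.* (n ∸ k) !) ℕ.*_) (nCk≡n!/k![n-k]! k≤n))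
  (m*[n/m]≡n {{k !* (n ∸ k) !≢0}} (k![n∸k]!∣n! k≤n)))

expSeries-suc-*-! : ∀ i k → expSeries i (suc k) * fromℕ (k !) ≡ fromℕ i * (+ (i ^ k) / suc k)
expSeries-suc-*-! i k = begin
  expSeries i (suc k) * fromℕ (k !)
    ≡⟨ cong (expSeries i (suc k) *_) (fromℕ-def (k !)) ⟩
  (+ (i ^ suc k) / suc k !) {{suc k !≢0}} * (+ (k !) / 1)
    ≡⟨ +/-*-+/ (i ^ suc k) (k !) (suc k !) 1 {{suc k !≢0}} ⟩
  (+ (i ^ suc k ℕ.* k !) / (suc k ! ℕ.* 1)) {{m*n≢0 (suc k !) 1 {{suc k !≢0}}}}
    ≡⟨ +/-cong-cross (i ^ suc k ℕ.* k !) (i ℕ.* i ^ k) (suc k ! ℕ.* 1) (suc k)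
         {{m*n≢0 (suc k !) 1 {{suc k !≢0}}}} (rearrange k i (i ^ k) (k !)) ⟩
  + (i ℕ.* i ^ k) / suc k
    ≡⟨ sym (fromℕ-*-+/ i (i ^ k) (suc k)) ⟩
  fromℕ i * (+ (i ^ k) / suc k) ∎
  where
  open ℕ-Solver.+-*-Solver
  rearrange : ∀ k i p f → ((i ℕ.* p) ℕ.* f) ℕ.* suc k ≡ (i ℕ.* p) ℕ.* ((suc k ℕ.* f) ℕ.* 1)
  rearrange = solve 4 (λ k i p f → ((i :* p) :* f) :* (con 1 :+ k)
                                 := (i :* p) :* (((con 1 :+ k) :* f) :* con 1)) refl

egf-*-! : ∀ G n → egf G n * fromℕ (n !) ≡ G n
egf-*-! G n = begin
  (G n * (+ 1 / n !) {{n !≢0}}) * fromℕ (n !)  ≡⟨ *-assoc (G n) _ _ ⟩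
  G n * ((+ 1 / n !) {{n !≢0}} * fromℕ (n !))  ≡⟨ cong (G n *_) (1/n*n≡1 (n !) {{n !≢0}}) ⟩
  G n * 1ℚ                                     ≡⟨ *-identityʳ (G n) ⟩
  G n                                          ∎

recurrenceCoeff : ℕ → ℕ → ℕ → ℚ
recurrenceCoeff a n k = fromℕ (n C k) * (+ (a ^ k) / suc k)

recurrenceCoeff-zero : ∀ a n → recurrenceCoeff a n 0 ≡ 1ℚ
recurrenceCoeff-zero a n = trans (*-identityʳ (fromℕ 1)) fromℕ-1

expSeries-*-egf-*-! : ∀ a G n k → k ≤ n →
  (expSeries a (suc k) * egf G (n ∸ k)) * fromℕ (n !) ≡ fromℕ a * (recurrenceCoeff a n k * G (n ∸ k))
expSeries-*-egf-*-! a G n k k≤n = begin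
  (E * egf G (n ∸ k)) * fromℕ (n !)
    ≡⟨ cong (λ m → (E * egf G (n ∸ k)) * fromℕ m) (n!≡k![n∸k]!*nCk n k k≤n) ⟩
  (E * egf G (n ∸ k)) * fromℕ ((k ! ℕ.* (n ∸ k) !) ℕ.* (n C k))
    ≡⟨ cong ((E * egf G (n ∸ k)) *_)
            (trans (fromℕ-* _ (n C k)) (cong (_* fromℕ (n C k)) (fromℕ-* (k !) ((n ∸ k) !)))) ⟩
  (E * egf G (n ∸ k)) * ((fromℕ (k !) * fromℕ ((n ∸ k) !)) * fromℕ (n C k))
    ≡⟨ regroup E (egf G (n ∸ k)) (fromℕ (k !)) (fromℕ ((n ∸ k) !)) (fromℕ (n C k)) ⟩
  (E * fromℕ (k !)) * (egf G (n ∸ k) * fromℕ ((n ∸ k) !)) * fromℕ (n C k)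
    ≡⟨ cong₂ (λ u v → u * v * fromℕ (n C k)) (expSeries-suc-*-! a k) (egf-*-! G (n ∸ k)) ⟩
  (fromℕ a * q) * G (n ∸ k) * fromℕ (n C k)
    ≡⟨ regroup′ (fromℕ a) q (G (n ∸ k)) (fromℕ (n C k)) ⟩
  fromℕ a * ((fromℕ (n C k) * q) * G (n ∸ k)) ∎
  where
  open ℚ-Solver.+-*-Solver
  E q : ℚ
  E = expSeries a (suc k)
  q = + (a ^ k) / suc k
  regroup : ∀ e g x y c → (e * g) * ((x * y) * c) ≡ (e * x) * (g * y) * c
  regroup = solve 5 (λ e g x y c → (e :* g) :* ((x :* y) :* c) := (e :* x) :* (g :* y) :* c) refl
  regroup′ : ∀ a q g c → (a * q) * g * c ≡ a * ((c * q) * g)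
  regroup′ = solve 4 (λ a q g c → (a :* q) :* g :* c := a :* ((c :* q) :* g)) refl

module _ (a : ℕ) .{{_ : NonZero a}} (G : ℕ → ℚ) (isG : IsGSeq a G) where

  recurrence : ∀ n →
    Σ< (suc n) (λ k → recurrenceCoeff a n k * G (n ∸ k)) * fromℕ a
      ≡ ((expSeries 1 ÷t) ⊛ atSeries a) n * fromℕ (n !)
  recurrence n = begin
    S * fromℕ a
      ≡⟨ *-comm S (fromℕ a) ⟩
    fromℕ a * S
      ≡⟨ *-distribˡ-Σ< (suc n) (fromℕ a) (λ k → recurrenceCoeff a n k * G (n ∸ k)) ⟩
    Σ< (suc n) (λ k → fromℕ a * (recurrenceCoeff a n k * G (n ∸ k)))
      ≡⟨ Σ<-cong (suc n) (λ k k<1+n → sym (expSeries-*-egf-*-! a G n k (ℕ.≤-pred k<1+n))) ⟩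
    Σ< (suc n) (λ k → (expSeries a (suc k) * egf G (n ∸ k)) * fromℕ (n !))
      ≡⟨ sym (*-distribʳ-Σ< (suc n) (fromℕ (n !)) (λ k → expSeries a (suc k) * egf G (n ∸ k))) ⟩
    ((expSeries a ÷t) ⊛ egf G) n * fromℕ (n !)
      ≡⟨ cong (_* fromℕ (n !)) (expSeries-÷t-⊛-egf a G isG n) ⟩
    ((expSeries 1 ÷t) ⊛ atSeries a) n * fromℕ (n !) ∎
    where
    S : ℚ
    S = Σ< (suc n) (λ k → recurrenceCoeff a n k * G (n ∸ k))

  G-zero : G 0 ≡ 0ℚ
  G-zero = *-cancelʳ-fromℕ a (G 0) 0ℚ (begin
    G 0 * fromℕ a                                             ≡⟨ cong (_* fromℕ a) (sym lead) ⟩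
    Σ< 1 (λ k → recurrenceCoeff a 0 k * G (0 ∸ k)) * fromℕ a  ≡⟨ recurrence 0 ⟩
    ((expSeries 1 ÷t) ⊛ atSeries a) 0 * fromℕ 1               ≡⟨ cong (_* fromℕ 1) (⊛-atSeries-zero (expSeries 1 ÷t) a) ⟩
    0ℚ * fromℕ 1                                              ≡⟨ *-zeroˡ (fromℕ 1) ⟩
    0ℚ                                                        ≡⟨ sym (*-zeroˡ (fromℕ a)) ⟩
    0ℚ * fromℕ a                                              ∎)
    where
    lead : 0ℚ + recurrenceCoeff a 0 0 * G 0 ≡ G 0
    lead = trans (+-identityˡ _) (trans (cong (_* G 0) (recurrenceCoeff-zero a 0)) (*-identityˡ (G 0)))

  G-suc : ∀ m → G (suc m) ≡ 1ℚ - Σ< (suc m) (λ k → recurrenceCoeff a (suc m) (suc k) * G (m ∸ k))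
  G-suc m = begin
    G (suc m)               ≡⟨ solve 2 (λ g t → g := (g :+ t) :- t) refl (G (suc m)) T ⟩
    (G (suc m) + T) - T     ≡⟨ cong (_- T) (*-cancelʳ-fromℕ a (G (suc m) + T) 1ℚ total) ⟩
    1ℚ - T                  ∎
    where
    open ℚ-Solver.+-*-Solver
    T : ℚ
    T = Σ< (suc m) (λ k → recurrenceCoeff a (suc m) (suc k) * G (m ∸ k))
    lead : recurrenceCoeff a (suc m) 0 * G (suc m) ≡ G (suc m)
    lead = trans (cong (_* G (suc m)) (recurrenceCoeff-zero a (suc m))) (*-identityˡ (G (suc m)))
    total : (G (suc m) + T) * fromℕ a ≡ 1ℚ * fromℕ a
    total = begin
      (G (suc m) + T) * fromℕ a
        ≡⟨ cong (λ g → (g + T) * fromℕ a) (sym lead) ⟩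
      (recurrenceCoeff a (suc m) 0 * G (suc m) + T) * fromℕ a
        ≡⟨ cong (_* fromℕ a) (sym (Σ<-head (suc m) (λ k → recurrenceCoeff a (suc m) k * G (suc m ∸ k)))) ⟩
      Σ< (suc (suc m)) (λ k → recurrenceCoeff a (suc m) k * G (suc m ∸ k)) * fromℕ a
        ≡⟨ recurrence (suc m) ⟩
      ((expSeries 1 ÷t) ⊛ atSeries a) (suc m) * fromℕ (suc m !)
        ≡⟨ cong (_* fromℕ (suc m !)) (⊛-atSeries-suc (expSeries 1 ÷t) a m) ⟩
      (expSeries 1 (suc m) * fromℕ a) * fromℕ (suc m !)
        ≡⟨ solve 3 (λ e x n → (e :* x) :* n := (e :* n) :* x) refl
                   (expSeries 1 (suc m)) (fromℕ a) (fromℕ (suc m !)) ⟩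
      (expSeries 1 (suc m) * fromℕ (suc m !)) * fromℕ a
        ≡⟨ cong (_* fromℕ a)
                (trans (cong (λ i → (+ i / suc m !) {{suc m !≢0}} * fromℕ (suc m !)) (ℕ.^-zeroˡ (suc m)))
                       (1/n*n≡1 (suc m !) {{suc m !≢0}})) ⟩
      1ℚ * fromℕ a ∎

record PIntegral (p : ℕ) (x : ℚ) : Set where
  constructor pIntegral
  field
    scale      : ℕ
    p∤scale    : ¬ p ∣ scale
    numerator  : ℤ
    x*scale≡numerator : x * fromℕ scale ≡ numerator / 1

/1-+-/1 : ∀ z w → (z / 1) + (w / 1) ≡ (z ℤ.+ w) / 1
/1-+-/1 z w = trans (/-+-/ z w 1 1) (cong (_/ 1) (cong₂ ℤ._+_ (ℤ.*-identityʳ z) (ℤ.*-identityʳ w)))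

module _ {p : ℕ} (p-prime : Prime p) where

  private instance
    p≢0 : NonZero p
    p≢0 = prime⇒nonZero p-prime
    p>1 : ℕ.NonTrivial p
    p>1 = prime⇒nonTrivial p-prime

  p∤1 : ¬ p ∣ 1
  p∤1 p∣1 = ¬prime[1] (subst Prime (∣1⇒≡1 p∣1) p-prime)

  p∤* : ∀ {m n} → ¬ p ∣ m → ¬ p ∣ n → ¬ p ∣ m ℕ.* n
  p∤* p∤m p∤n p∣mn with euclidsLemma _ _ p-prime p∣mn
  ... | inj₁ p∣m = p∤m p∣m
  ... | inj₂ p∣n = p∤n p∣n

  PIntegral-/1 : ∀ z → PIntegral p (z / 1)
  PIntegral-/1 z = pIntegral 1 p∤1 z (trans (cong ((z / 1) *_) fromℕ-1) (*-identityʳ (z / 1)))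

  PIntegral-fromℕ : ∀ n → PIntegral p (fromℕ n)
  PIntegral-fromℕ n = subst (PIntegral p) (sym (fromℕ-def n)) (PIntegral-/1 (+ n))

  PIntegral-+ : ∀ {x y} → PIntegral p x → PIntegral p y → PIntegral p (x + y)
  PIntegral-+ {x} {y} (pIntegral v p∤v z xv≡z) (pIntegral w p∤w z′ yw≡z′) =
    pIntegral (v ℕ.* w) (p∤* p∤v p∤w) (z ℤ.* + w ℤ.+ z′ ℤ.* + v) (begin
      (x + y) * fromℕ (v ℕ.* w)
        ≡⟨ cong ((x + y) *_) (fromℕ-* v w) ⟩
      (x + y) * (fromℕ v * fromℕ w)
        ≡⟨ solve 4 (λ x y v w → (x :+ y) :* (v :* w) := (x :* v) :* w :+ (y :* w) :* v) refl
                   x y (fromℕ v) (fromℕ w) ⟩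
      (x * fromℕ v) * fromℕ w + (y * fromℕ w) * fromℕ v
        ≡⟨ cong₂ (λ s t → s * fromℕ w + t * fromℕ v) xv≡z yw≡z′ ⟩
      (z / 1) * fromℕ w + (z′ / 1) * fromℕ v
        ≡⟨ cong₂ (λ s t → (z / 1) * s + (z′ / 1) * t) (fromℕ-def w) (fromℕ-def v) ⟩
      (z / 1) * (+ w / 1) + (z′ / 1) * (+ v / 1)
        ≡⟨ cong₂ _+_ (/-*-/ z (+ w) 1 1) (/-*-/ z′ (+ v) 1 1) ⟩
      ((z ℤ.* + w) / 1) + ((z′ ℤ.* + v) / 1)
        ≡⟨ /1-+-/1 (z ℤ.* + w) (z′ ℤ.* + v) ⟩
      (z ℤ.* + w ℤ.+ z′ ℤ.* + v) / 1 ∎)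
    where open ℚ-Solver.+-*-Solver

  PIntegral-* : ∀ {x y} → PIntegral p x → PIntegral p y → PIntegral p (x * y)
  PIntegral-* {x} {y} (pIntegral v p∤v z xv≡z) (pIntegral w p∤w z′ yw≡z′) =
    pIntegral (v ℕ.* w) (p∤* p∤v p∤w) (z ℤ.* z′) (begin
      (x * y) * fromℕ (v ℕ.* w)
        ≡⟨ cong ((x * y) *_) (fromℕ-* v w) ⟩
      (x * y) * (fromℕ v * fromℕ w)
        ≡⟨ solve 4 (λ x y v w → (x :* y) :* (v :* w) := (x :* v) :* (y :* w)) refl
                   x y (fromℕ v) (fromℕ w) ⟩
      (x * fromℕ v) * (y * fromℕ w)
        ≡⟨ cong₂ _*_ xv≡z yw≡z′ ⟩
      (z / 1) * (z′ / 1)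
        ≡⟨ /-*-/ z z′ 1 1 ⟩
      (z ℤ.* z′) / 1 ∎)
    where open ℚ-Solver.+-*-Solver

  PIntegral-neg : ∀ {x} → PIntegral p x → PIntegral p (- x)
  PIntegral-neg {x} (pIntegral v p∤v z xv≡z) =
    pIntegral v p∤v (ℤ.- z)
      (trans (sym (neg-distribˡ-* x (fromℕ v))) (trans (cong -_ xv≡z) (-‿/ z 1)))

  PIntegral-Σ< : ∀ n f → (∀ k → k < n → PIntegral p (f k)) → PIntegral p (Σ< n f)
  PIntegral-Σ< zero    f _ = PIntegral-/1 (+ 0)
  PIntegral-Σ< (suc n) f integral =
    PIntegral-+ (PIntegral-Σ< n f (λ k k<n → integral k (ℕ.m<n⇒m<1+n k<n))) (integral n (ℕ.n<1+n n))

  p-freePart : ∀ n .{{_ : NonZero n}} → Acc _<_ n →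
               Σ[ s ∈ ℕ ] Σ[ w ∈ ℕ ] (n ≡ p ^ s ℕ.* w) × ¬ p ∣ w
  p-freePart n (acc rs) with p ∣? n
  ... | no p∤n = 0 , n , sym (ℕ.*-identityˡ n) , p∤n
  ... | yes p∣n with p-freePart (quotient p∣n) {{quotient≢0 p∣n}} (rs (quotient-< p∣n))
  ...   | s , w , q≡pˢw , p∤w = suc s , w , (begin
    n                        ≡⟨ m∣n⇒n≡quotient*m p∣n ⟩
    quotient p∣n ℕ.* p       ≡⟨ cong (ℕ._* p) q≡pˢw ⟩
    (p ^ s ℕ.* w) ℕ.* p      ≡⟨ solve 3 (λ P Q W → (Q :* W) :* P := (P :* Q) :* W) refl p (p ^ s) w ⟩
    (p ^ suc s) ℕ.* w        ∎) , p∤w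
    where open ℕ-Solver.+-*-Solver

  n<p^n : ∀ n → n < p ^ n
  n<p^n zero    = s≤s z≤n
  n<p^n (suc n) = ℕ.<-≤-trans (s≤s (n<p^n n))
    (ℕ.≤-trans (ℕ.+-monoˡ-≤ (p ^ n) (ℕ.m^n>0 p n))
    (ℕ.≤-trans (ℕ.≤-reflexive (cong (p ^ n ℕ.+_) (sym (ℕ.+-identityʳ (p ^ n)))))
               (ℕ.*-monoˡ-≤ (p ^ n) (ℕ.nonTrivial⇒n>1 p))))

  ^-monoʳ-∣ : ∀ {s n} → s ≤ n → p ^ s ∣ p ^ n
  ^-monoʳ-∣ {s} {n} s≤n = subst (p ^ s ∣_)
    (trans (sym (ℕ.^-distribˡ-+-* p s (n ∸ s))) (cong (p ^_) (ℕ.m+[n∸m]≡n s≤n)))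
    (m∣m*n (p ^ (n ∸ s)))

  ^-monoˡ-∣ : ∀ {a} n → p ∣ a → p ^ n ∣ a ^ n
  ^-monoˡ-∣ zero    p∣a = ∣-refl
  ^-monoˡ-∣ (suc n) p∣a = *-pres-∣ p∣a (^-monoˡ-∣ n p∣a)

  -- Writing m + 1 = pˢ w with p ∤ w, we have s ≤ m since s < pˢ ≤ m + 1, so pˢ ∣ pᵐ ∣ aᵐ.
  PIntegral-^/suc : ∀ {a} → p ∣ a → ∀ m → PIntegral p (+ (a ^ m) / suc m)
  PIntegral-^/suc {a} p∣a m with p-freePart (suc m) (<-wellFounded (suc m))
  ... | s , w , 1+m≡pˢw , p∤w = pIntegral w p∤w (+ q) (begin
    (+ (a ^ m) / suc m) * fromℕ w                 ≡⟨ cong ((+ (a ^ m) / suc m) *_) (fromℕ-def w) ⟩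
    (+ (a ^ m) / suc m) * (+ w / 1)               ≡⟨ +/-*-+/ (a ^ m) w (suc m) 1 ⟩
    + (a ^ m ℕ.* w) / (suc m ℕ.* 1)               ≡⟨ +/-cong-cross (a ^ m ℕ.* w) q (suc m ℕ.* 1) 1 cross ⟩
    + q / 1                                       ∎)
    where
    pˢ∣1+m : p ^ s ∣ suc m
    pˢ∣1+m = subst (p ^ s ∣_) (sym 1+m≡pˢw) (m∣m*n w)
    s≤m : s ≤ m
    s≤m = ℕ.≤-pred (ℕ.<-≤-trans (n<p^n s) (∣⇒≤ pˢ∣1+m))
    pˢ∣aᵐ : p ^ s ∣ a ^ m
    pˢ∣aᵐ = ∣-trans (^-monoʳ-∣ s≤m) (^-monoˡ-∣ m p∣a)
    q : ℕ
    q = quotient pˢ∣aᵐ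
    cross : (a ^ m ℕ.* w) ℕ.* 1 ≡ q ℕ.* (suc m ℕ.* 1)
    cross = begin
      (a ^ m ℕ.* w) ℕ.* 1
        ≡⟨ cong (λ t → (t ℕ.* w) ℕ.* 1) (m∣n⇒n≡m*quotient pˢ∣aᵐ) ⟩
      ((p ^ s ℕ.* q) ℕ.* w) ℕ.* 1
        ≡⟨ solve 3 (λ P q w → ((P :* q) :* w) :* con 1 := q :* ((P :* w) :* con 1)) refl (p ^ s) q w ⟩
      q ℕ.* ((p ^ s ℕ.* w) ℕ.* 1)
        ≡⟨ cong (λ t → q ℕ.* (t ℕ.* 1)) (sym 1+m≡pˢw) ⟩
      q ℕ.* (suc m ℕ.* 1) ∎
      where open ℕ-Solver.+-*-Solver

  -- From x = n / d in lowest terms and x v = z we get d ∣ n v, hence d ∣ v, so p ∤ d.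
  PIntegral⇒ValNonneg : ∀ x → PIntegral p x → ValNonneg p x
  PIntegral⇒ValNonneg _                   _                  _ k₁ zero     _ _          = z≤n
  PIntegral⇒ValNonneg x@(mkℚ n d-1 n⊥d) (pIntegral v p∤v z xv≡z) _ k₁ (suc k₂) _ (pᵏ⁺¹∣d , _) =
    ⊥-elim (p∤v (∣-trans (∣-trans (m∣m*n (p ^ k₂)) pᵏ⁺¹∣d) d∣v))
    where
    d : ℕ
    d = suc d-1
    nv/d≡z : (n ℤ.* + v) / (d ℕ.* 1) ≡ z / 1
    nv/d≡z = begin
      (n ℤ.* + v) / (d ℕ.* 1)  ≡⟨ sym (/-*-/ n (+ v) d 1) ⟩
      (n / d) * (+ v / 1)      ≡⟨ cong₂ _*_ (↥p/↧p≡p x) (sym (fromℕ-def v)) ⟩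
      x * fromℕ v              ≡⟨ xv≡z ⟩
      z / 1                    ∎
    nv≡zd : n ℤ.* + v ≡ z ℤ.* + d
    nv≡zd = begin
      n ℤ.* + v            ≡⟨ sym (ℤ.*-identityʳ (n ℤ.* + v)) ⟩
      (n ℤ.* + v) ℤ.* + 1  ≡⟨ /≡/⇒cross (n ℤ.* + v) z (d ℕ.* 1) 1 nv/d≡z ⟩
      z ℤ.* + (d ℕ.* 1)    ≡⟨ cong (λ e → z ℤ.* + e) (ℕ.*-identityʳ d) ⟩
      z ℤ.* + d            ∎
    d∣v : d ∣ v
    d∣v = Coprime.coprime-divisor (Coprime.sym (Coprime.recompute n⊥d))
      (divides ℤ.∣ z ∣ (trans (sym (ℤ.abs-* n (+ v)))
                             (trans (cong ℤ.∣_∣ nv≡zd) (ℤ.abs-* z (+ d)))))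

  G-PIntegral : ∀ a .{{_ : NonZero a}} G → IsGSeq a G → p ∣ a → ∀ n → PIntegral p (G n)
  G-PIntegral a G isG p∣a = <-rec (λ n → PIntegral p (G n)) step
    where
    coeff : ∀ n k → PIntegral p (recurrenceCoeff a n k)
    coeff n k = PIntegral-* (PIntegral-fromℕ (n C k)) (PIntegral-^/suc p∣a k)
    step : ∀ n → (∀ {m} → m < n → PIntegral p (G m)) → PIntegral p (G n)
    step zero    _  = subst (PIntegral p) (sym (G-zero a G isG)) (PIntegral-/1 (+ 0))
    step (suc m) ih = subst (PIntegral p) (sym (G-suc a G isG m))
      (PIntegral-+ (PIntegral-/1 (+ 1)) (PIntegral-neg (PIntegral-Σ< (suc m) _
        (λ k k<1+m → PIntegral-* (coeff (suc m) (suc k)) (ih (s≤s (ℕ.m∸n≤m m k)))))))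

corollary4 : (a n : ℕ) → a ≥ 2 → n ≥ 1 →
    (G : ℕ → ℚ) → IsGSeq a G →
    (p : ℕ) → Prime p → p ∣ a → ValNonneg p (G n)
corollary4 a n a≥2 _ G isG p p-prime p∣a =
  PIntegral⇒ValNonneg p-prime (G n) (G-PIntegral p-prime a G isG p∣a n)
  where instance
  a≢0 : NonZero a
  a≢0 = ℕ.>-nonZero (ℕ.≤-trans (s≤s z≤n) a≥2)
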